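{- Let $G$ be a diameter-2-critical graph with critical paths fixed as described in the context. For distinct triangles $T,T'$ of $G$, the sets $\mathcal{F}(T)$ and $\mathcal{F}(T')$ are disjoint.
   Context: All graphs are finite and simple; $d_G(x,y)$ is the shortest-path distance. $G$ is diameter-2-critical if its diameter is 2 and for every edge $e$, $G-e$ has diameter greater than 2. A vertex pair $\{x,y\}$ and edge $e$ are associated if $d_G(x,y)\le 2$ but $d_{G-e}(x,y)>2$; $\{x,y\}$ is critical if some edge is associated with it. For each critical pair $\{x,y\}$ one shortest $(x,y)$-path $P_{xy}$ is arbitrarily selected. For an edge $e$, $\mathcal{P}(e)$ is the set of these selected paths $P_{xy}$ with $\{x,y\}$ associated with $e$. For a triangle $T$, a vertex $v\notin T$ is a foot of $T$ if there are $x,y\in T$ such that the path $vxy$ belongs to $\mathcal{P}(xy)$. $\mathcal{F}(T)$ is the set of all unordered triples $\{v,y,z\}$ inducing exactly one edge in $G$ such that $v$ is a foot of $T$, $y,z\in T$, and $v$ is adjacent to neither $y$ nor $z$. -}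

module Defs where

open import Data.Nat using (ℕ)
open import Data.Fin using (Fin)
open import Data.Maybe using (Maybe; just; nothing)
open import Data.Product using (_×_; Σ; ∃; ∃-syntax; _,_)
open import Data.Sum using (_⊎_)
open import Relation.Nullary using (¬_; Dec)
open import Relation.Binary.PropositionalEquality using (_≡_)

record Graph (n : ℕ) : Set₁ where
  field
    Adj    : Fin n → Fin n → Set
    sym    : ∀ {x y} → Adj x y → Adj y x
    irrefl : ∀ {x} → ¬ Adj x x
    dec    : ∀ x y → Dec (Adj x y)
open Graph public

module _ {n : ℕ} where

  Dist≤2 : (Fin n → Fin n → Set) → Fin n → Fin n → Set
  Dist≤2 A x y = x ≡ y ⊎ A x y ⊎ (∃[ z ] (A x z × A z y))

  SamePair : Fin n → Fin n → Fin n → Fin n → Set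
  SamePair a b u w = (a ≡ u × b ≡ w) ⊎ (a ≡ w × b ≡ u)

  AdjMinus : Graph n → Fin n → Fin n → Fin n → Fin n → Set
  AdjMinus G u w a b = Adj G a b × ¬ SamePair a b u w

  Diameter2 : Graph n → Set
  Diameter2 G = (∀ x y → Dist≤2 (Adj G) x y)
              × (∃[ x ] ∃[ y ] (¬ x ≡ y × ¬ Adj G x y))

  Diameter2Critical : Graph n → Set
  Diameter2Critical G = Diameter2 G
    × (∀ u w → Adj G u w → ∃[ x ] ∃[ y ] ¬ Dist≤2 (AdjMinus G u w) x y)

  Associated : Graph n → Fin n → Fin n → Fin n → Fin n → Set
  Associated G x y u w = Adj G u w × Dist≤2 (Adj G) x y
                       × ¬ Dist≤2 (AdjMinus G u w) x y

  Critical : Graph n → Fin n → Fin n → Set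
  Critical G x y = ∃[ u ] ∃[ w ] Associated G x y u w

  -- A selection of one shortest path P_xy for every critical pair {x,y}.
  -- A shortest (x,y)-path of length ≤ 2 between distinct x,y is encoded by
  -- its interior: 'nothing' is the single-edge path xy, 'just z' is the
  -- path xzy.  The selection is for the unordered pair, hence symmetric.
  record PathSelection (G : Graph n) : Set where
    field
      P     : Fin n → Fin n → Maybe (Fin n)
      symm  : ∀ x y → Critical G x y → P x y ≡ P y x
      edge  : ∀ x y → Critical G x y → P x y ≡ nothing → Adj G x y
      two   : ∀ x y z → Critical G x y → P x y ≡ just z →
              Adj G x z × Adj G z y × ¬ Adj G x y
  open PathSelection public

  module _ (G : Graph n) (S : PathSelection G) where

    -- the path v x y belongs to 𝒫(xy): it is the selected path P_vy of
    -- a pair {v,y} associated with the edge xy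
    PathInP : Fin n → Fin n → Fin n → Set
    PathInP v x y = Associated G v y x y × P S v y ≡ just x

    IsTriangle : Fin n → Fin n → Fin n → Set
    IsTriangle a b c = Adj G a b × Adj G b c × Adj G a c

    _∈₃_ : Fin n → (Fin n × Fin n × Fin n) → Set
    v ∈₃ (a , b , c) = v ≡ a ⊎ v ≡ b ⊎ v ≡ c

    SameSet₃ : (Fin n × Fin n × Fin n) → (Fin n × Fin n × Fin n) → Set
    SameSet₃ s t = (∀ v → v ∈₃ s → v ∈₃ t) × (∀ v → v ∈₃ t → v ∈₃ s)

    Foot : (Fin n × Fin n × Fin n) → Fin n → Set
    Foot T v = ¬ (v ∈₃ T) × (∃[ x ] ∃[ y ] (x ∈₃ T × y ∈₃ T × PathInP v x y))

    ExactlyOneEdge : Fin n → Fin n → Fin n → Set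
    ExactlyOneEdge a b c =
      (¬ a ≡ b × ¬ a ≡ c × ¬ b ≡ c)
      × ((Adj G a b × ¬ Adj G a c × ¬ Adj G b c)
         ⊎ (¬ Adj G a b × Adj G a c × ¬ Adj G b c)
         ⊎ (¬ Adj G a b × ¬ Adj G a c × Adj G b c))

    InF : (Fin n × Fin n × Fin n) → (Fin n × Fin n × Fin n) → Set
    InF T t = ∃[ v ] ∃[ y ] ∃[ z ]
      ( SameSet₃ t (v , y , z)
      × ExactlyOneEdge v y z
      × Foot T v
      × y ∈₃ T × z ∈₃ T
      × ¬ Adj G v y × ¬ Adj G v z )

-- A triple {v,y,z} of 𝓕(T) has yz as its only edge, so both its isolated
-- vertex v and the edge yz are determined by the triple; hence T and T'
-- share the edge yz and v is a foot of both. Let x and x₂ be the third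
-- vertices of T and T'. As a foot of T, v is adjacent to x and the selected
-- path v x x' (x' ∈ {y,z}) lies in 𝒫(xx'), so x is the only common
-- neighbour of v and x' (otherwise v and x' stay at distance 2 in G - xx').
-- But v ~ x₂ ~ x', so x₂ = x and T = T'.
module Submission where

open import Defs
open import Data.Nat using (ℕ)
open import Data.Fin using (Fin; _≟_)
open import Data.Product using (_×_; _,_; ∃-syntax)
open import Data.Sum using (_⊎_; inj₁; inj₂; fromInj₂)
open import Data.Empty using (⊥-elim)
open import Function using (_∘_)
open import Relation.Nullary using (¬_; yes; no)
open import Relation.Binary.PropositionalEquality using (_≡_; refl; subst; ≢-sym)

subst-either : ∀ {a p} {A : Set a} (P : A → Set p) {y z w : A} →
  P y → P z → w ≡ y ⊎ w ≡ z → P w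
subst-either P py _ (inj₁ refl) = py
subst-either P _ pz (inj₂ refl) = pz

pair-cover : ∀ {a} {A : Set a} {s s' u q r : A} →
  u ≡ s ⊎ u ≡ s' → q ≡ s ⊎ q ≡ s' → r ≡ s ⊎ r ≡ s' → ¬ q ≡ r → u ≡ q ⊎ u ≡ r
pair-cover (inj₁ refl) (inj₁ refl) _           _   = inj₁ refl
pair-cover (inj₂ refl) (inj₂ refl) _           _   = inj₁ refl
pair-cover (inj₁ refl) (inj₂ refl) (inj₁ refl) _   = inj₂ refl
pair-cover (inj₂ refl) (inj₁ refl) (inj₂ refl) _   = inj₂ refl
pair-cover _           (inj₁ refl) (inj₁ refl) q≢r = ⊥-elim (q≢r refl)
pair-cover _           (inj₂ refl) (inj₂ refl) q≢r = ⊥-elim (q≢r refl)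

module Triangles {n : ℕ} (G : Graph n) (S : PathSelection G) where

  Triple : Set
  Triple = Fin n × Fin n × Fin n

  _∈_ : Fin n → Triple → Set
  v ∈ T = _∈₃_ G S v T

  _⊆_ : Triple → Triple → Set
  T ⊆ T' = ∀ v → v ∈ T → v ∈ T'

  ⊆-trans : ∀ {T T' T''} → T ⊆ T' → T' ⊆ T'' → T ⊆ T''
  ⊆-trans T⊆T' T'⊆T'' v = T'⊆T'' v ∘ T⊆T' v

  ∈-tail : ∀ {w v p q} → w ∈ (v , p , q) → ¬ w ≡ v → w ≡ p ⊎ w ≡ q
  ∈-tail w∈T w≢v = fromInj₂ (⊥-elim ∘ w≢v) w∈T

  members-⊆ : ∀ {p q r T} → p ∈ T → q ∈ T → r ∈ T → (p , q , r) ⊆ T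
  members-⊆ p∈T _ _ _ (inj₁ refl) = p∈T
  members-⊆ _ q∈T _ _ (inj₂ (inj₁ refl)) = q∈T
  members-⊆ _ _ r∈T _ (inj₂ (inj₂ refl)) = r∈T

  ∈-front : ∀ {p T} → p ∈ T → ∃[ q ] ∃[ r ] T ⊆ (p , q , r)
  ∈-front {T = a , b , c} (inj₁ refl) = b , c , λ _ w∈T → w∈T
  ∈-front {T = a , b , c} (inj₂ (inj₁ refl)) = a , c , λ
    { _ (inj₁ w≡a)         → inj₂ (inj₁ w≡a)
    ; _ (inj₂ (inj₁ w≡b))  → inj₁ w≡b
    ; _ (inj₂ (inj₂ w≡c))  → inj₂ (inj₂ w≡c) }
  ∈-front {T = a , b , c} (inj₂ (inj₂ refl)) = a , b , λ
    { _ (inj₁ w≡a)         → inj₂ (inj₁ w≡a)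
    ; _ (inj₂ (inj₁ w≡b))  → inj₂ (inj₂ w≡b)
    ; _ (inj₂ (inj₂ w≡c))  → inj₁ w≡c }

  distinct-members-cover : ∀ {p q r T} → p ∈ T → q ∈ T → r ∈ T →
    ¬ p ≡ q → ¬ p ≡ r → ¬ q ≡ r → T ⊆ (p , q , r)
  distinct-members-cover {p} {T = T} p∈T q∈T r∈T p≢q p≢r q≢r u u∈T with ∈-front p∈T
  ... | s , s' , T⊆pss' with T⊆pss' u u∈T
  ...   | inj₁ u≡p = inj₁ u≡p
  ...   | inj₂ u∈ss' = inj₂ (pair-cover u∈ss' (in-ss' q∈T (≢-sym p≢q)) (in-ss' r∈T (≢-sym p≢r)) q≢r)
    where
      in-ss' : ∀ {w} → w ∈ T → ¬ w ≡ p → w ≡ s ⊎ w ≡ s'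
      in-ss' w∈T = ∈-tail (T⊆pss' _ w∈T)

  shared-members⇒SameSet₃ : ∀ {p q r T T'} →
    p ∈ T → q ∈ T → r ∈ T → p ∈ T' → q ∈ T' → r ∈ T' →
    ¬ p ≡ q → ¬ p ≡ r → ¬ q ≡ r → SameSet₃ G S T T'
  shared-members⇒SameSet₃ p∈T q∈T r∈T p∈T' q∈T' r∈T' p≢q p≢r q≢r =
    ⊆-trans (distinct-members-cover p∈T q∈T r∈T p≢q p≢r q≢r) (members-⊆ p∈T' q∈T' r∈T') ,
    ⊆-trans (distinct-members-cover p∈T' q∈T' r∈T' p≢q p≢r q≢r) (members-⊆ p∈T q∈T r∈T)

  adj⇒≢ : ∀ {u w} → Adj G u w → ¬ u ≡ w
  adj⇒≢ u~w refl = irrefl G u~w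

  adj-nonadj⇒≢ : ∀ {v x y} → Adj G v x → ¬ Adj G v y → ¬ x ≡ y
  adj-nonadj⇒≢ v~x v≁y refl = v≁y v~x

  triangle-adj : ∀ {a b c u w} → IsTriangle G S a b c →
    u ∈ (a , b , c) → w ∈ (a , b , c) → ¬ u ≡ w → Adj G u w
  triangle-adj _              (inj₁ refl)        (inj₁ refl)        u≢w = ⊥-elim (u≢w refl)
  triangle-adj (a~b , _ , _)  (inj₁ refl)        (inj₂ (inj₁ refl)) _   = a~b
  triangle-adj (_ , _ , a~c)  (inj₁ refl)        (inj₂ (inj₂ refl)) _   = a~c
  triangle-adj (a~b , _ , _)  (inj₂ (inj₁ refl)) (inj₁ refl)        _   = sym G a~b
  triangle-adj _              (inj₂ (inj₁ refl)) (inj₂ (inj₁ refl)) u≢w = ⊥-elim (u≢w refl)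
  triangle-adj (_ , b~c , _)  (inj₂ (inj₁ refl)) (inj₂ (inj₂ refl)) _   = b~c
  triangle-adj (_ , _ , a~c)  (inj₂ (inj₂ refl)) (inj₁ refl)        _   = sym G a~c
  triangle-adj (_ , b~c , _)  (inj₂ (inj₂ refl)) (inj₂ (inj₁ refl)) _   = sym G b~c
  triangle-adj _              (inj₂ (inj₂ refl)) (inj₂ (inj₂ refl)) u≢w = ⊥-elim (u≢w refl)

  common-neighbour-of-associated-pair : ∀ {v w x u} → Associated G v w x w →
    Adj G v u → Adj G u w → u ≡ x
  common-neighbour-of-associated-pair {v} {w} {x} {u} (_ , _ , far) v~u u~w with u ≟ x
  ... | yes u≡x = u≡x
  ... | no u≢x = ⊥-elim (far (inj₂ (inj₂ (u , (v~u , vu≠xw) , (u~w , uw≠xw)))))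
    where
      vu≠xw : ¬ SamePair v u x w
      vu≠xw (inj₁ (_ , u≡w)) = adj⇒≢ u~w u≡w
      vu≠xw (inj₂ (_ , u≡x)) = u≢x u≡x
      uw≠xw : ¬ SamePair u w x w
      uw≠xw (inj₁ (u≡x , _)) = u≢x u≡x
      uw≠xw (inj₂ (u≡w , _)) = adj⇒≢ u~w u≡w

  foot-path : ∀ {T v} → Foot G S T v →
    ∃[ x ] ∃[ x' ] (x ∈ T × x' ∈ T × Adj G v x × Adj G x x' × Associated G v x' x x')
  foot-path (_ , x , x' , x∈T , x'∈T , assoc , P≡x) =
    let v~x , x~x' , _ = two S _ x' x (x , x' , assoc) P≡x
    in x , x' , x∈T , x'∈T , v~x , x~x' , assoc

  nonadjacent-within : ∀ {v y z w} → ¬ Adj G v y → ¬ Adj G v z →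
    w ∈ (v , y , z) → ¬ Adj G v w
  nonadjacent-within _   _   (inj₁ refl)        = irrefl G
  nonadjacent-within v≁y _   (inj₂ (inj₁ refl)) = v≁y
  nonadjacent-within _   v≁z (inj₂ (inj₂ refl)) = v≁z

  isolated-vertex-unique : ∀ {v y z v' y' z'} → Adj G y z →
    ¬ Adj G v' y' → ¬ Adj G v' z' →
    SameSet₃ G S (v , y , z) (v' , y' , z') → v' ≡ v
  isolated-vertex-unique {y = y} {z} {v'} y~z v'≁y' v'≁z' (⊆' , ⊇') with ⊇' v' (inj₁ refl)
  ... | inj₁ v'≡v = v'≡v
  ... | inj₂ (inj₁ refl) =
    ⊥-elim (nonadjacent-within v'≁y' v'≁z' (⊆' z (inj₂ (inj₂ refl))) y~z)
  ... | inj₂ (inj₂ refl) =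
    ⊥-elim (nonadjacent-within v'≁y' v'≁z' (⊆' y (inj₂ (inj₁ refl))) (sym G y~z))

  shared-description : ∀ {a b c T' t} → IsTriangle G S a b c →
    InF G S (a , b , c) t → InF G S T' t →
    ∃[ v ] ∃[ y ] ∃[ z ] (Foot G S (a , b , c) v × Foot G S T' v
      × y ∈ (a , b , c) × z ∈ (a , b , c) × y ∈ T' × z ∈ T'
      × ¬ y ≡ z × ¬ Adj G v y × ¬ Adj G v z)
  shared-description {T' = T'} tri
    (v , y , z , (t⊆vyz , vyz⊆t) , ((v≢y , v≢z , y≢z) , _) , foot , y∈T , z∈T , v≁y , v≁z)
    (v' , y' , z' , (t⊆v'y'z' , v'y'z'⊆t) , _ , foot' , y'∈T' , z'∈T' , v'≁y' , v'≁z')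
    with isolated-vertex-unique (triangle-adj tri y∈T z∈T y≢z) v'≁y' v'≁z'
           (⊆-trans vyz⊆t t⊆v'y'z' , ⊆-trans v'y'z'⊆t t⊆vyz)
  ... | refl = v , y , z , foot , foot' , y∈T , z∈T ,
               in-T' (inj₂ (inj₁ refl)) (≢-sym v≢y) , in-T' (inj₂ (inj₂ refl)) (≢-sym v≢z) ,
               y≢z , v≁y , v≁z
    where
      in-T' : ∀ {w} → w ∈ (v , y , z) → ¬ w ≡ v → w ∈ T'
      in-T' w∈t w≢v =
        subst-either (_∈ T') y'∈T' z'∈T' (∈-tail (t⊆v'y'z' _ (vyz⊆t _ w∈t)) w≢v)

  shared-foot⇒SameSet₃ : ∀ {a b c a' b' c' v y z} →
    IsTriangle G S a b c → IsTriangle G S a' b' c' →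
    Foot G S (a , b , c) v → Foot G S (a' , b' , c') v →
    y ∈ (a , b , c) → z ∈ (a , b , c) → y ∈ (a' , b' , c') → z ∈ (a' , b' , c') →
    ¬ y ≡ z → ¬ Adj G v y → ¬ Adj G v z →
    SameSet₃ G S (a , b , c) (a' , b' , c')
  shared-foot⇒SameSet₃ {a' = a'} {b'} {c'} {y = y} {z} tri tri' foot foot'
    y∈T z∈T y∈T' z∈T' y≢z v≁y v≁z
    with foot-path foot | foot-path foot'
  ... | x , x' , x∈T , x'∈T , v~x , x~x' , assoc | x₂ , _ , x₂∈T' , _ , v~x₂ , _ =
    shared-members⇒SameSet₃ x∈T y∈T z∈T x∈T' y∈T' z∈T' x≢y x≢z y≢z
    where
      x≢y = adj-nonadj⇒≢ v~x v≁y
      x≢z = adj-nonadj⇒≢ v~x v≁z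
      x'∈yz : x' ≡ y ⊎ x' ≡ z
      x'∈yz = ∈-tail (distinct-members-cover x∈T y∈T z∈T x≢y x≢z y≢z x' x'∈T)
                     (adj⇒≢ (sym G x~x'))
      x₂~x' : Adj G x₂ x'
      x₂~x' = subst-either (Adj G x₂)
        (triangle-adj tri' x₂∈T' y∈T' (adj-nonadj⇒≢ v~x₂ v≁y))
        (triangle-adj tri' x₂∈T' z∈T' (adj-nonadj⇒≢ v~x₂ v≁z)) x'∈yz
      x∈T' : x ∈ (a' , b' , c')
      x∈T' = subst (_∈ (a' , b' , c')) (common-neighbour-of-associated-pair assoc v~x₂ x₂~x') x₂∈T'

lemma4p4 : {n : ℕ} (G : Graph n) (S : PathSelection G) →
    Diameter2Critical G →
    (a b c a' b' c' : Fin n) →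
    IsTriangle G S a b c → IsTriangle G S a' b' c' →
    ¬ SameSet₃ G S (a , b , c) (a' , b' , c') →
    (t : Fin n × Fin n × Fin n) →
    ¬ (InF G S (a , b , c) t × InF G S (a' , b' , c') t)
lemma4p4 G S _ a b c a' b' c' tri tri' T≉T' t (t∈𝓕T , t∈𝓕T')
  with Triangles.shared-description G S tri t∈𝓕T t∈𝓕T'
... | v , y , z , foot , foot' , y∈T , z∈T , y∈T' , z∈T' , y≢z , v≁y , v≁z =
  T≉T' (Triangles.shared-foot⇒SameSet₃ G S tri tri' foot foot' y∈T z∈T y∈T' z∈T' y≢z v≁y v≁z)
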